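{- Let $\mathbb D$ be the reflexive digraph on $\{0,1,2\}$ whose non-loop edges are $0\to1$, $1\to0$, $1\to2$, $2\to0$, and let $\mathbb K$ be the reflexive digraph on $\{0,1,2,3\}$ whose non-loop edges are $0\to1$, $1\to0$, $1\to2$, $2\to3$, $3\to2$, $3\to0$. Let $\mathbf D$ (resp. $\mathbf K$) be the algebra on $\{0,1,2\}$ (resp. $\{0,1,2,3\}$) whose basic operations are all idempotent polymorphisms of $\mathbb D$ (resp. $\mathbb K$), and let $\mathcal D$ and $\mathcal K$ be the varieties generated by $\mathbf D$ and $\mathbf K$ respectively. Then (1) the variety $\mathcal{SL}$ of semilattices and $\mathcal D$ are equi-interpretable; (2) the variety $\mathcal{SET}$ of sets and $\mathcal K$ are equi-interpretable.
   Context: A polymorphism of a digraph $\mathbb G$ is an operation $f:G^n\to G$ such that whenever $a_i\to b_i$ in $\mathbb G$ for all $i$, $f(a_1,\dots,a_n)\to f(b_1,\dots,b_n)$; it is idempotent if $f(x,\dots,x)=x$. The clone of a nontrivial variety is the clone of term operations of its free algebra on countably many generators (for a trivial variety, the clone of the one-element algebra); equivalently the clone of any generating algebra may be used. A variety $\mathcal V$ interprets in a variety $\mathcal W$ if there is a clone homomorphism (a map sending projections to corresponding projections and commuting with composition) from the clone of $\mathcal V$ to the clone of $\mathcal W$. Two varieties are equi-interpretable if each interprets in the other. $\mathcal{SET}$ is the variety with empty signature. -}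

module Defs where

open import Data.Nat using (ℕ)
open import Data.Fin using (Fin)
open import Data.Fin.Patterns using (0F; 1F; 2F; 3F)
open import Data.Bool using (Bool; _∧_)
open import Data.Empty using (⊥)
open import Data.Unit using (⊤; tt)
open import Data.Product using (Σ; _×_; proj₁; proj₂)
open import Relation.Binary.PropositionalEquality using (_≡_)

Op : Set → ℕ → Set
Op A n = (Fin n → A) → A

record Algebra : Set₁ where
  field
    Carrier : Set
    Sym     : Set
    ar      : Sym → ℕ
    interp  : (s : Sym) → Op Carrier (ar s)

module _ (𝔸 : Algebra) where
  open Algebra 𝔸

  data Term (n : ℕ) : Set where
    var : Fin n → Term n
    app : (s : Sym) → (Fin (ar s) → Term n) → Term n

  ⟦_⟧ : ∀ {n} → Term n → Op Carrier n
  ⟦ var i ⟧   x = x i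
  ⟦ app s ts ⟧ x = interp s (λ j → ⟦ ts j ⟧ x)

  _[_] : ∀ {m n} → Term m → (Fin m → Term n) → Term n
  var i    [ σ ] = σ i
  app s ts [ σ ] = app s (λ j → ts j [ σ ])

-- Clone homomorphism from the clone of term operations of 𝔸 to that of 𝔹.
-- Term operations are represented by terms modulo equality of the
-- operations they denote (pointwise).

record CloneHom (𝔸 𝔹 : Algebra) : Set where
  module A = Algebra 𝔸
  module B = Algebra 𝔹
  field
    h    : ∀ {n} → Term 𝔸 n → Term 𝔹 n
    resp : ∀ {n} (t u : Term 𝔸 n) → (∀ x → ⟦_⟧ 𝔸 t x ≡ ⟦_⟧ 𝔸 u x) →
           ∀ y → ⟦_⟧ 𝔹 (h t) y ≡ ⟦_⟧ 𝔹 (h u) y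
    proj : ∀ {n} (i : Fin n) → ∀ y → ⟦_⟧ 𝔹 (h (var i)) y ≡ y i
    comp : ∀ {m n} (t : Term 𝔸 m) (σ : Fin m → Term 𝔸 n) → ∀ y →
           ⟦_⟧ 𝔹 (h (_[_] 𝔸 t σ)) y ≡ ⟦_⟧ 𝔹 (h t) (λ i → ⟦_⟧ 𝔹 (h (σ i)) y)

-- 𝔸 interprets in 𝔹  (varieties given by generating algebras)
Interprets : Algebra → Algebra → Set
Interprets 𝔸 𝔹 = CloneHom 𝔸 𝔹

EquiInterpretable : Algebra → Algebra → Set
EquiInterpretable 𝔸 𝔹 = Interprets 𝔸 𝔹 × Interprets 𝔹 𝔸

IsPolymorphism : {V : Set} → (V → V → Set) → ∀ {n} → Op V n → Set
IsPolymorphism {V} E {n} f =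
  (a b : Fin n → V) → (∀ i → E (a i) (b i)) → E (f a) (f b)

IsIdempotent : {V : Set} → ∀ {n} → Op V n → Set
IsIdempotent {V} f = (x : V) → f (λ _ → x) ≡ x

IdemPol : {V : Set} → (V → V → Set) → Set
IdemPol {V} E = Σ ℕ λ n → Σ (Op V n) λ f → IsPolymorphism E f × IsIdempotent f

IdemPolAlgebra : (V : Set) → (V → V → Set) → Algebra
IdemPolAlgebra V E = record
  { Carrier = V
  ; Sym     = IdemPol E
  ; ar      = proj₁
  ; interp  = λ s → proj₁ (proj₂ s)
  }

data EdgeD : Fin 3 → Fin 3 → Set where
  loop : ∀ x → EdgeD x x
  e01  : EdgeD 0F 1F
  e10  : EdgeD 1F 0F
  e12  : EdgeD 1F 2F
  e20  : EdgeD 2F 0F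

data EdgeK : Fin 4 → Fin 4 → Set where
  loop : ∀ x → EdgeK x x
  e01  : EdgeK 0F 1F
  e10  : EdgeK 1F 0F
  e12  : EdgeK 1F 2F
  e23  : EdgeK 2F 3F
  e32  : EdgeK 3F 2F
  e30  : EdgeK 3F 0F

𝐃 : Algebra
𝐃 = IdemPolAlgebra (Fin 3) EdgeD

𝐊 : Algebra
𝐊 = IdemPolAlgebra (Fin 4) EdgeK

-- two-element semilattice ({0,1}, ∧), generates the variety SL
SL₂ : Algebra
SL₂ = record
  { Carrier = Bool
  ; Sym     = ⊤
  ; ar      = λ _ → 2
  ; interp  = λ _ x → x 0F ∧ x 1F
  }

-- two-element set with empty signature, generates SET
SET₂ : Algebra
SET₂ = record
  { Carrier = Bool
  ; Sym     = ⊥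
  ; ar      = λ ()
  ; interp  = λ ()
  }

-- On the interval {1, 2} of 𝔻 and of 𝕂 (1 → 2 is an edge, 2 → 1 is not, and no other vertex z
-- has 1 → z → 2), an idempotent polymorphism restricts to a monotone Boolean function g with
-- g(0…0) = 0 and g(1…1) = 1. Gadget vectors of vertices, whose edges a polymorphism carries to
-- its outputs, show that g preserves meets, and in 𝕂 that g cannot reject two vectors whose
-- join is 1…1. So g is the indicator of a proper filter of Bool ^ n, i.e. a conjunction of a
-- nonempty set of variables, and in 𝕂 a single variable. Replacing every basic operation by
-- that term of SL₂ (resp. SET₂) is a clone homomorphism, because each term then denotes the
-- restriction of its operation. Conversely ∧ goes to min along 0 < 1 < 2, a polymorphism of 𝔻,
-- and SET₂ has no operations to translate.
module Submission where

open import Defs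
open import Data.Nat using (ℕ; zero; suc)
open import Data.Fin using (Fin; zero; suc; _≤_)
open import Data.Fin.Patterns using (0F; 1F; 2F; 3F)
open import Data.Fin.Properties using (_≟_; _≤?_; ≤-refl; ≤-antisym; ≤-totalOrder; all?; ¬∀⟶∃¬)
open import Data.Bool using (Bool; true; false; T; _∧_)
open import Data.Bool.Properties using (T?; T-∧; T-≡)
open import Data.Vec.Functional using (_∷_; []; zipWith)
open import Data.Empty using (⊥-elim)
open import Data.Unit using (⊤; tt)
open import Data.Product using (Σ-syntax; ∃-syntax; _×_; _,_; proj₁; proj₂)
open import Data.Sum using (_⊎_; inj₁; inj₂; [_,_]′)
open import Function using (_∘_; id; const; _⇔_; mk⇔; Equivalence)
open import Relation.Nullary using (¬_; Dec; yes; no; does; contradiction)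
open import Relation.Nullary.Decidable
  using (decidable-stable; dec-true; dec-false; does-⇔; toWitness; _×-dec_; _→-dec_)
open import Relation.Binary.PropositionalEquality
  using (_≡_; _≢_; refl; sym; trans; cong; cong₂; subst; subst₂; module ≡-Reasoning)
import Algebra.Construct.NaturalChoice.Min as Min

open ≡-Reasoning

T-injective : ∀ {a b} → T a ⇔ T b → a ≡ b
T-injective {false} {false} _   = refl
T-injective {true}  {true}  _   = refl
T-injective {true}  {false} a⇔b = ⊥-elim (Equivalence.to a⇔b tt)
T-injective {false} {true}  a⇔b = ⊥-elim (Equivalence.from a⇔b tt)

Extensional : Algebra → Set
Extensional 𝔹 = ∀ s (a b : Fin (ar s) → Carrier) → (∀ j → a j ≡ b j) → interp s a ≡ interp s b
  where open Algebra 𝔹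

Substitutive : (𝔹 : Algebra) → ∀ {m} → Term 𝔹 m → Set
Substitutive 𝔹 {m} u = ∀ {n} (ρ : Fin m → Term 𝔹 n) y b →
  (∀ j → ⟦_⟧ 𝔹 (ρ j) y ≡ b j) → ⟦_⟧ 𝔹 (_[_] 𝔹 u ρ) y ≡ ⟦_⟧ 𝔹 u b

extensional⇒substitutive : ∀ {𝔹} → Extensional 𝔹 → ∀ {m} (u : Term 𝔹 m) → Substitutive 𝔹 u
extensional⇒substitutive ext (var i)    ρ y b ρ≗b = ρ≗b i
extensional⇒substitutive ext (app s us) ρ y b ρ≗b =
  ext s _ _ (λ j → extensional⇒substitutive ext (us j) ρ y b ρ≗b)

module Translation {𝔸 𝔹 : Algebra}
  (τ : (s : Algebra.Sym 𝔸) → Term 𝔹 (Algebra.ar 𝔸 s))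
  (τ-substitutive : ∀ s → Substitutive 𝔹 (τ s))
  where

  open Algebra 𝔸 using (ar) renaming (Carrier to A; interp to interpᴬ)
  open Algebra 𝔹 using () renaming (Carrier to B)

  private
    ⟦_⟧ᴬ : ∀ {n} → Term 𝔸 n → Op A n
    ⟦_⟧ᴬ = ⟦_⟧ 𝔸

    ⟦_⟧ᴮ : ∀ {n} → Term 𝔹 n → Op B n
    ⟦_⟧ᴮ = ⟦_⟧ 𝔹

  translate : ∀ {n} → Term 𝔸 n → Term 𝔹 n
  translate (var i)    = var i
  translate (app s ts) = _[_] 𝔹 (τ s) (λ j → translate (ts j))

  translate-[] : ∀ {m n} (t : Term 𝔸 m) (σ : Fin m → Term 𝔸 n) y →
    ⟦ translate (_[_] 𝔸 t σ) ⟧ᴮ y ≡ ⟦ translate t ⟧ᴮ (λ i → ⟦ translate (σ i) ⟧ᴮ y)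
  translate-[] (var i)    σ y = refl
  translate-[] {m} (app s ts) σ y = begin
    ⟦ _[_] 𝔹 (τ s) (λ j → translate (_[_] 𝔸 (ts j) σ)) ⟧ᴮ y
      ≡⟨ τ-substitutive s _ y _ (λ j → translate-[] (ts j) σ y) ⟩
    ⟦ τ s ⟧ᴮ (λ j → ⟦ translate (ts j) ⟧ᴮ y′)
      ≡⟨ τ-substitutive s _ y′ _ (λ _ → refl) ⟨
    ⟦ _[_] 𝔹 (τ s) (λ j → translate (ts j)) ⟧ᴮ y′ ∎
    where
    y′ : Fin m → B
    y′ i = ⟦ translate (σ i) ⟧ᴮ y

  -- Stated for every argument vector pointwise equal to φ ∘ b: without function
  -- extensionality the basic operations of 𝔸 need not respect pointwise equality.
  IsReductHomomorphism : (B → A) → Set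
  IsReductHomomorphism φ = ∀ s (b : Fin (ar s) → B) (a : Fin (ar s) → A) →
    (∀ j → a j ≡ φ (b j)) → interpᴬ s a ≡ φ (⟦ τ s ⟧ᴮ b)

  translate-sound : ∀ {φ} → IsReductHomomorphism φ → ∀ {n} (t : Term 𝔸 n) y a →
    (∀ i → a i ≡ φ (y i)) → ⟦ t ⟧ᴬ a ≡ φ (⟦ translate t ⟧ᴮ y)
  translate-sound φ-hom (var i)    y a a≗ = a≗ i
  translate-sound {φ} φ-hom (app s ts) y a a≗ = begin
    interpᴬ s (λ j → ⟦ ts j ⟧ᴬ a)
      ≡⟨ φ-hom s _ _ (λ j → translate-sound {φ} φ-hom (ts j) y a a≗) ⟩
    φ (⟦ τ s ⟧ᴮ (λ j → ⟦ translate (ts j) ⟧ᴮ y))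
      ≡⟨ cong φ (τ-substitutive s _ y _ (λ _ → refl)) ⟨
    φ (⟦ translate (app s ts) ⟧ᴮ y) ∎

  -- The family φ embeds the τ-reduct of 𝔹 into a power of 𝔸, so that reduct satisfies
  -- every identity of 𝔸; this is what makes translation well defined on term operations.
  cloneHom : {C : Set} (φ : C → B → A) → (∀ c → IsReductHomomorphism (φ c)) →
    (∀ {u v} → (∀ c → φ c u ≡ φ c v) → u ≡ v) → CloneHom 𝔸 𝔹
  cloneHom φ φ-hom φ-separates = record
    { h    = translate
    ; resp = λ t u t≗u y → φ-separates λ c → begin
        φ c (⟦ translate t ⟧ᴮ y)   ≡⟨ translate-sound {φ c} (φ-hom c) t y _ (λ _ → refl) ⟨
        ⟦ t ⟧ᴬ (λ i → φ c (y i))   ≡⟨ t≗u _ ⟩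
        ⟦ u ⟧ᴬ (λ i → φ c (y i))   ≡⟨ translate-sound {φ c} (φ-hom c) u y _ (λ _ → refl) ⟩
        φ c (⟦ translate u ⟧ᴮ y)   ∎
    ; proj = λ i y → refl
    ; comp = translate-[]
    }

_≼_ : ∀ {n} → (x y : Fin n → Bool) → Set
x ≼ y = ∀ k → T (x k) → T (y k)

MeetClosed : ∀ {n} → ((Fin n → Bool) → Bool) → Set
MeetClosed g = ∀ x y → T (g x) → T (g y) → T (g (zipWith _∧_ x y))

CoverPrime : ∀ {n} → ((Fin n → Bool) → Bool) → Set
CoverPrime g = ∀ x y → (∀ k → T (x k) ⊎ T (y k)) → T (g x) ⊎ T (g y)

record IsFilter {n} (g : (Fin n → Bool) → Bool) : Set where
  field
    upward : ∀ {x y} → x ≼ y → T (g x) → T (g y)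
    meet   : MeetClosed g
    top    : T (g (const true))

coatom : ∀ {n} → Fin n → Fin n → Bool
coatom zero    = false ∷ const true
coatom (suc i) = true ∷ coatom i

≼-coatom : ∀ {n} {x : Fin n → Bool} i → ¬ T (x i) → x ≼ coatom i
≼-coatom         zero    x✗ zero    xₖ = contradiction xₖ x✗
≼-coatom         zero    x✗ (suc k) _  = tt
≼-coatom         (suc i) x✗ zero    _  = tt
≼-coatom {x = x} (suc i) x✗ (suc k) xₖ = ≼-coatom {x = x ∘ suc} i x✗ k xₖ

coatom-cover : ∀ {n} {i j : Fin n} → i ≢ j → ∀ k → T (coatom i k) ⊎ T (coatom j k)
coatom-cover {i = zero}  {zero}  i≢j _       = contradiction refl i≢j
coatom-cover {i = zero}  {suc j} _   zero    = inj₂ tt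
coatom-cover {i = zero}  {suc j} _   (suc k) = inj₁ tt
coatom-cover {i = suc i} {zero}  _   zero    = inj₁ tt
coatom-cover {i = suc i} {zero}  _   (suc k) = inj₂ tt
coatom-cover {i = suc i} {suc j} _   zero    = inj₁ tt
coatom-cover {i = suc i} {suc j} i≢j (suc k) = coatom-cover (i≢j ∘ cong suc) k

filter-face : ∀ {n} {g : (Fin (suc n) → Bool) → Bool} → IsFilter g → IsFilter (λ x → g (true ∷ x))
filter-face F = record
  { upward = λ x≼y → upward λ { zero _ → tt ; (suc k) → x≼y k }
  ; meet   = λ x y gx gy → upward (λ { zero _ → tt ; (suc k) → id }) (meet _ _ gx gy)
  ; top    = upward (λ { zero _ → tt ; (suc k) _ → tt }) top
  }
  where open IsFilter F

-- x = (x₀, 1, …, 1) ∧ (1, x₁, …, xₙ₋₁), and the second factor lies on the face x₀ = 1.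
filter-complete : ∀ {n} {g : (Fin n → Bool) → Bool} → IsFilter g →
  ∀ x → (∀ i → ¬ T (g (coatom i)) → T (x i)) → T (g x)
filter-complete {zero}      F x _      = IsFilter.upward F (λ ()) (IsFilter.top F)
filter-complete {suc n} {g} F x covers = upward ≼x (meet _ _ head-accepted tail-accepted)
  where
  open IsFilter F

  head-accepted : T (g (x zero ∷ const true))
  head-accepted with x zero | covers zero
  ... | true  | _          = upward (λ { zero _ → tt ; (suc _) _ → tt }) top
  ... | false | x₀-covered = decidable-stable (T? _) x₀-covered

  tail-accepted : T (g (true ∷ (x ∘ suc)))
  tail-accepted = filter-complete (filter-face F) (x ∘ suc) (covers ∘ suc)

  ≼x : zipWith _∧_ (x zero ∷ const true) (true ∷ (x ∘ suc)) ≼ x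
  ≼x zero    = proj₁ ∘ Equivalence.to T-∧
  ≼x (suc k) = id

filter-sound : ∀ {n} {g : (Fin n → Bool) → Bool} → IsFilter g →
  ∀ {x} → T (g x) → ∀ i → ¬ T (g (coatom i)) → T (x i)
filter-sound F gx i rejected =
  decidable-stable (T? _) λ x✗ → rejected (IsFilter.upward F (≼-coatom i x✗) gx)

rejected-coatom : ∀ {n} {g : (Fin n → Bool) → Bool} → IsFilter g →
  ¬ T (g (const false)) → ∃[ i ] ¬ T (g (coatom i))
rejected-coatom {n} F proper = ¬∀⟶∃¬ n _ (λ i → T? _) λ all-accepted →
  proper (filter-complete F (const false) λ i rejected → rejected (all-accepted i))

SL₂-extensional : Extensional SL₂
SL₂-extensional _ a b a≗b = cong₂ _∧_ (a≗b 0F) (a≗b 1F)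

_∧ₜ_ : ∀ {n} → Term SL₂ n → Term SL₂ n → Term SL₂ n
u ∧ₜ v = app tt (u ∷ v ∷ [])

⋀ : ∀ {m n} → (Fin (suc m) → Term SL₂ n) → Term SL₂ n
⋀ {zero}  u = u zero
⋀ {suc m} u = u zero ∧ₜ ⋀ (u ∘ suc)

⋀-sound : ∀ {m n} (u : Fin (suc m) → Term SL₂ n) x →
  T (⟦_⟧ SL₂ (⋀ u) x) → ∀ j → T (⟦_⟧ SL₂ (u j) x)
⋀-sound {zero}  u x h zero    = h
⋀-sound {suc m} u x h zero    = proj₁ (Equivalence.to T-∧ h)
⋀-sound {suc m} u x h (suc j) = ⋀-sound (u ∘ suc) x (proj₂ (Equivalence.to T-∧ h)) j

⋀-complete : ∀ {m n} (u : Fin (suc m) → Term SL₂ n) x →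
  (∀ j → T (⟦_⟧ SL₂ (u j) x)) → T (⟦_⟧ SL₂ (⋀ u) x)
⋀-complete {zero}  u x h = h zero
⋀-complete {suc m} u x h = Equivalence.from T-∧ (h zero , ⋀-complete (u ∘ suc) x (h ∘ suc))

proper-filter-term : ∀ {n} {g : (Fin n → Bool) → Bool} → IsFilter g → ¬ T (g (const false)) →
  Σ[ u ∈ Term SL₂ n ] ∀ x → ⟦_⟧ SL₂ u x ≡ g x
proper-filter-term {zero} F proper = contradiction (IsFilter.upward F (λ ()) (IsFilter.top F)) proper
proper-filter-term {suc n} {g} F proper with rejected-coatom F proper
... | i₀ , rejected₀ = ⋀ (var ∘ pick) , λ x → T-injective (mk⇔ (conj⇒g x) (g⇒conj x))
  where
  -- the coordinates g ignores are replaced by i₀, so the conjunction runs over all of Fin n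
  pick : Fin (suc n) → Fin (suc n)
  pick i with T? (g (coatom i))
  ... | yes _ = i₀
  ... | no  _ = i

  pick-rejected : ∀ i → ¬ T (g (coatom i)) → pick i ≡ i
  pick-rejected i rejected with T? (g (coatom i))
  ... | yes accepted = contradiction accepted rejected
  ... | no  _        = refl

  picked : ∀ {x} → T (g x) → ∀ i → T (x (pick i))
  picked gx i with T? (g (coatom i))
  ... | yes _        = filter-sound F gx i₀ rejected₀
  ... | no  rejected = filter-sound F gx i rejected

  conj⇒g : ∀ x → T (⟦_⟧ SL₂ (⋀ (var ∘ pick)) x) → T (g x)
  conj⇒g x h = filter-complete F x λ i rejected →
    subst (T ∘ x) (pick-rejected i rejected) (⋀-sound (var ∘ pick) x h i)

  g⇒conj : ∀ x → T (g x) → T (⟦_⟧ SL₂ (⋀ (var ∘ pick)) x)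
  g⇒conj x gx = ⋀-complete (var ∘ pick) x (picked gx)

prime-filter-coordinate : ∀ {n} {g : (Fin n → Bool) → Bool} → IsFilter g →
  ¬ T (g (const false)) → CoverPrime g → ∃[ i ] ∀ x → g x ≡ x i
prime-filter-coordinate {g = g} F proper prime with rejected-coatom F proper
... | i₀ , rejected₀ = i₀ , λ x → T-injective (mk⇔
        (λ gx → filter-sound F gx i₀ rejected₀)
        (λ xi₀ → filter-complete F x λ i rejected → subst (T ∘ x) (sym (only-i₀ i rejected)) xi₀))
  where
  only-i₀ : ∀ i → ¬ T (g (coatom i)) → i ≡ i₀
  only-i₀ i rejected with i ≟ i₀
  ... | yes i≡i₀ = i≡i₀
  ... | no  i≢i₀ = ⊥-elim ([ rejected , rejected₀ ]′ (prime _ _ (coatom-cover i≢i₀)))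

module _ {V : Set} (E : V → V → Set) {n} {f : Op V n}
         (pol : IsPolymorphism E f) (idem : IsIdempotent f) where

  edge-from-const : ∀ {u b} → (∀ k → E u (b k)) → E u (f b)
  edge-from-const {u} {b} e = subst (λ w → E w (f b)) (idem u) (pol (λ _ → u) b e)

  edge-to-const : ∀ {a u} → (∀ k → E (a k) u) → E (f a) u
  edge-to-const {a} {u} e = subst (E (f a)) (idem u) (pol a (λ _ → u) e)

module TwoElementInterval
  {V : Set} (E : V → V → Set) (E-refl : ∀ z → E z z)
  {o t : V} (o→t : E o t) (t↛o : ¬ E t o)
  (interval : ∀ {z} → E o z → E z t → z ≡ o ⊎ z ≡ t)
  (_≟t : ∀ z → Dec (z ≡ t))
  where

  enc : Bool → V
  enc false = o
  enc true  = t

  enc-between : ∀ p → E o (enc p) × E (enc p) t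
  enc-between false = E-refl o , o→t
  enc-between true  = o→t , E-refl t

  enc-mono : ∀ {p q} → (T p → T q) → E (enc p) (enc q)
  enc-mono {false} {false} _   = E-refl o
  enc-mono {false} {true}  _   = o→t
  enc-mono {true}  {true}  _   = E-refl t
  enc-mono {true}  {false} p⇒q = ⊥-elim (p⇒q tt)

  enc-reflects : ∀ {p q} → E (enc p) (enc q) → T p → T q
  enc-reflects {true} {true}  _   _ = tt
  enc-reflects {true} {false} t→o _ = t↛o t→o
  enc-reflects {false}        _   ()

  enc-antisym : ∀ {p q} → E (enc p) (enc q) → E (enc q) (enc p) → p ≡ q
  enc-antisym pq qp = T-injective (mk⇔ (enc-reflects pq) (enc-reflects qp))

  enc-injective : ∀ {p q} → enc p ≡ enc q → p ≡ q
  enc-injective {p} p≡q =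
    enc-antisym (subst (E (enc p)) p≡q (E-refl _)) (subst (λ w → E w (enc p)) p≡q (E-refl _))

  between⇒enc : ∀ {z} → E o z → E z t → ∃[ p ] z ≡ enc p
  between⇒enc o→z z→t with interval o→z z→t
  ... | inj₁ z≡o = false , z≡o
  ... | inj₂ z≡t = true , z≡t

  module _ {n} {f : Op V n} (pol : IsPolymorphism E f) (idem : IsIdempotent f) where

    restrict : (Fin n → Bool) → Bool
    restrict x = does (f (enc ∘ x) ≟t)

    f-between : ∀ {a : Fin n → V} (x : Fin n → Bool) → (∀ k → a k ≡ enc (x k)) → ∃[ p ] f a ≡ enc p
    f-between x a≗ = between⇒enc
      (edge-from-const E pol idem λ k → subst (E o) (sym (a≗ k)) (proj₁ (enc-between (x k))))
      (edge-to-const E pol idem λ k → subst (λ w → E w t) (sym (a≗ k)) (proj₂ (enc-between (x k))))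

    restrict-sound : ∀ x → f (enc ∘ x) ≡ enc (restrict x)
    restrict-sound x with f (enc ∘ x) ≟t | f-between {enc ∘ x} x (λ _ → refl)
    ... | yes fx≡t | _            = fx≡t
    ... | no  _    | false , fx≡o = fx≡o
    ... | no  fx≢t | true  , fx≡t = contradiction fx≡t fx≢t

    f-on-image : ∀ {a : Fin n → V} (x : Fin n → Bool) → (∀ k → a k ≡ enc (x k)) → f a ≡ enc (restrict x)
    f-on-image {a} x a≗ with f-between x a≗
    ... | p , fa≡p = begin
      f a          ≡⟨ fa≡p ⟩
      enc p        ≡⟨ cong enc (enc-antisym (subst₂ E fa≡p fx≡r (pol _ _ a→x))
                                            (subst₂ E fx≡r fa≡p (pol _ _ x→a))) ⟩
      enc (restrict x) ∎
      where
      fx≡r : f (enc ∘ x) ≡ enc (restrict x)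
      fx≡r = restrict-sound x
      a→x : ∀ k → E (a k) (enc (x k))
      a→x k = subst (E (a k)) (a≗ k) (E-refl _)
      x→a : ∀ k → E (enc (x k)) (a k)
      x→a k = subst (λ w → E w (a k)) (a≗ k) (E-refl _)

    restrict-const : ∀ p → restrict (const p) ≡ p
    restrict-const p = enc-injective (trans (sym (restrict-sound (const p))) (idem (enc p)))

    restrict-proper : ¬ T (restrict (const false))
    restrict-proper = subst T (restrict-const false)

    restrict-filter : MeetClosed restrict → IsFilter restrict
    restrict-filter meet = record
      { upward = λ {x} {y} x≼y → enc-reflects
          (subst₂ E (restrict-sound x) (restrict-sound y) (pol _ _ λ k → enc-mono {x k} {y k} (x≼y k)))
      ; meet   = meet
      ; top    = subst T (sym (restrict-const true)) tt
      }

    accepted⇒t : ∀ {x} → T (restrict x) → f (enc ∘ x) ≡ t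
    accepted⇒t {x} accepted = trans (restrict-sound x) (cong enc (Equivalence.to T-≡ accepted))

    rejected⇒o : ∀ {x} → ¬ T (restrict x) → f (enc ∘ x) ≡ o
    rejected⇒o {x} rejected with restrict x | restrict-sound x
    ... | true  | _    = ⊥-elim (rejected tt)
    ... | false | fx≡o = fx≡o

    t→⇒accepted : ∀ {x} → E t (f (enc ∘ x)) → T (restrict x)
    t→⇒accepted {x} t→fx = enc-reflects (subst (E t) (restrict-sound x) t→fx) tt

  restriction : (s : IdemPol E) → (Fin (proj₁ s) → Bool) → Bool
  restriction (_ , _ , pol , idem) = restrict pol idem

  restriction-on-image : ∀ s {a} b → (∀ k → a k ≡ enc (b k)) →
    Algebra.interp (IdemPolAlgebra V E) s a ≡ enc (restriction s b)
  restriction-on-image (_ , _ , pol , idem) = f-on-image pol idem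

  restriction-filter : ∀ s → MeetClosed (restriction s) → IsFilter (restriction s)
  restriction-filter (_ , _ , pol , idem) = restrict-filter pol idem

  restriction-proper : ∀ s → ¬ T (restriction s (const false))
  restriction-proper (_ , _ , pol , idem) = restrict-proper pol idem

  interprets-in-SL₂ : (∀ s → MeetClosed (restriction s)) → Interprets (IdemPolAlgebra V E) SL₂
  interprets-in-SL₂ meet-closed = cloneHom (λ _ → enc) (λ _ → τ-hom) (λ enc≡ → enc-injective (enc≡ tt))
    where
    representation : ∀ s → Σ[ u ∈ Term SL₂ (proj₁ s) ] ∀ x → ⟦_⟧ SL₂ u x ≡ restriction s x
    representation s = proper-filter-term (restriction-filter s (meet-closed s)) (restriction-proper s)

    τ : (s : IdemPol E) → Term SL₂ (proj₁ s)
    τ s = proj₁ (representation s)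

    open Translation τ (λ s → extensional⇒substitutive SL₂-extensional (τ s))

    τ-hom : IsReductHomomorphism enc
    τ-hom s b a a≗ = trans (restriction-on-image s b a≗) (cong enc (sym (proj₂ (representation s) b)))

  interprets-in-SET₂ : (∀ s → MeetClosed (restriction s)) → (∀ s → CoverPrime (restriction s)) →
    Interprets (IdemPolAlgebra V E) SET₂
  interprets-in-SET₂ meet-closed cover-prime =
    cloneHom (λ _ → enc) (λ _ → τ-hom) (λ enc≡ → enc-injective (enc≡ tt))
    where
    coordinate : ∀ s → ∃[ i ] ∀ x → restriction s x ≡ x i
    coordinate s = prime-filter-coordinate
      (restriction-filter s (meet-closed s)) (restriction-proper s) (cover-prime s)

    τ : (s : IdemPol E) → Term SET₂ (proj₁ s)
    τ s = var (proj₁ (coordinate s))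

    open Translation τ (λ s → extensional⇒substitutive (λ ()) (τ s))

    τ-hom : IsReductHomomorphism enc
    τ-hom s b a a≗ = trans (restriction-on-image s b a≗) (cong enc (proj₂ (coordinate s) b))

module _ {n : ℕ} where
  open Min (≤-totalOrder n) using (_⊓_; ⊓-glb; x≤y⊓z⇒x≤y; x≤y⊓z⇒x≤z)

  ≤?-⊓ : ∀ (c a b : Fin n) → does (c ≤? a ⊓ b) ≡ does (c ≤? a) ∧ does (c ≤? b)
  ≤?-⊓ c a b = does-⇔
    (mk⇔ (λ c≤a⊓b → x≤y⊓z⇒x≤y a b c≤a⊓b , x≤y⊓z⇒x≤z a b c≤a⊓b) λ (c≤a , c≤b) → ⊓-glb c≤a c≤b)
    (c ≤? a ⊓ b) (c ≤? a ×-dec c ≤? b)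

  ≤?-separates : ∀ {a b : Fin n} → (∀ c → does (c ≤? a) ≡ does (c ≤? b)) → a ≡ b
  ≤?-separates {a} {b} same = ≤-antisym (below (same a)) (below (sym (same b)))
    where
    below : ∀ {x y : Fin n} → does (x ≤? x) ≡ does (x ≤? y) → x ≤ y
    below {x} {y} e = decidable-stable (x ≤? y) λ x≰y →
      contradiction (trans (trans (sym (dec-true (x ≤? x) ≤-refl)) e) (dec-false (x ≤? y) x≰y)) λ ()

module 𝔻 where

  between : ∀ {z} → EdgeD 1F z → EdgeD z 2F → z ≡ 1F ⊎ z ≡ 2F
  between {0F} _ ()
  between {1F} _ _ = inj₁ refl
  between {2F} _ _ = inj₂ refl

  open TwoElementInterval EdgeD loop e12 (λ ()) between (_≟ 2F)

  lower : Bool → Bool → Fin 3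
  lower false _ = 0F
  lower true  q = enc q

  y→lower : ∀ p q → EdgeD (enc q) (lower p q)
  y→lower false false = e10
  y→lower false true  = e20
  y→lower true  q     = loop _

  lower→x : ∀ p q → EdgeD (lower p q) (enc p)
  lower→x false _     = e01
  lower→x true  false = e12
  lower→x true  true  = loop _

  lower→meet : ∀ p q → EdgeD (lower p q) (enc (p ∧ q))
  lower→meet false _ = e01
  lower→meet true  _ = loop _

  only-2 : ∀ {z} → EdgeD 2F z → EdgeD z 2F → z ≡ 2F
  only-2 {0F} _  ()
  only-2 {1F} () _
  only-2 {2F} _  _ = refl

  -- 2 = f (enc y) → f l → f (enc x) = 2 forces f l = 2, and l → enc (x ∧ y) pointwise.
  meet-closed : ∀ s → MeetClosed (restriction s)
  meet-closed (n , f , pol , idem) x y x✓ y✓ =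
    t→⇒accepted pol idem (subst₂ EdgeD flower≡2 refl (pol l _ λ k → lower→meet (x k) (y k)))
    where
    l : Fin n → Fin 3
    l k = lower (x k) (y k)
    flower≡2 : f l ≡ 2F
    flower≡2 = only-2
      (subst₂ EdgeD (accepted⇒t pol idem y✓) refl (pol _ l λ k → y→lower (x k) (y k)))
      (subst₂ EdgeD refl (accepted⇒t pol idem x✓) (pol l _ λ k → lower→x (x k) (y k)))

  𝐃-in-SL₂ : Interprets 𝐃 SL₂
  𝐃-in-SL₂ = interprets-in-SL₂ meet-closed

  open Min (≤-totalOrder 3) using (_⊓_; ⊓-idem)

  EdgeD? : ∀ x y → Dec (EdgeD x y)
  EdgeD? 0F 0F = yes (loop _)
  EdgeD? 0F 1F = yes e01
  EdgeD? 0F 2F = no λ ()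
  EdgeD? 1F 0F = yes e10
  EdgeD? 1F 1F = yes (loop _)
  EdgeD? 1F 2F = yes e12
  EdgeD? 2F 0F = yes e20
  EdgeD? 2F 1F = no λ ()
  EdgeD? 2F 2F = yes (loop _)

  ⊓-polymorphism : ∀ x y z w → EdgeD x y → EdgeD z w → EdgeD (x ⊓ z) (y ⊓ w)
  ⊓-polymorphism = toWitness {a? = all? λ x → all? λ y → all? λ z → all? λ w →
    EdgeD? x y →-dec EdgeD? z w →-dec EdgeD? (x ⊓ z) (y ⊓ w)} _

  ⊓-idemPol : IdemPol EdgeD
  ⊓-idemPol = 2 , (λ v → v 0F ⊓ v 1F) , (λ a b e → ⊓-polymorphism _ _ _ _ (e 0F) (e 1F)) , ⊓-idem

  SL₂-in-𝐃 : Interprets SL₂ 𝐃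
  SL₂-in-𝐃 = cloneHom (λ c b → does (c ≤? b)) τ-hom ≤?-separates
    where
    τ : ⊤ → Term 𝐃 2
    τ _ = app ⊓-idemPol var

    τ-substitutive : ∀ s → Substitutive 𝐃 (τ s)
    τ-substitutive _ ρ y b ρ≗b = cong₂ _⊓_ (ρ≗b 0F) (ρ≗b 1F)

    open Translation τ τ-substitutive

    τ-hom : ∀ c → IsReductHomomorphism (λ b → does (c ≤? b))
    τ-hom c _ b a a≗ = trans (cong₂ _∧_ (a≗ 0F) (a≗ 1F)) (sym (≤?-⊓ c (b 0F) (b 1F)))

module 𝕂 where

  between : ∀ {z} → EdgeK 1F z → EdgeK z 2F → z ≡ 1F ⊎ z ≡ 2F
  between {0F} _  ()
  between {1F} _  _ = inj₁ refl
  between {2F} _  _ = inj₂ refl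
  between {3F} () _

  open TwoElementInterval EdgeK loop e12 (λ ()) between (_≟ 2F)

  lower : Bool → Bool → Fin 4
  lower false _ = 0F
  lower true  q = enc q

  upper : Bool → Bool → Fin 4
  upper _     false = 0F
  upper true  true  = 2F
  upper false true  = 3F

  y→upper : ∀ p q → EdgeK (enc q) (upper p q)
  y→upper _     false = e10
  y→upper true  true  = loop _
  y→upper false true  = e23

  upper→lower : ∀ p q → EdgeK (upper p q) (lower p q)
  upper→lower false false = loop _
  upper→lower true  false = e01
  upper→lower true  true  = loop _
  upper→lower false true  = e30

  lower→x : ∀ p q → EdgeK (lower p q) (enc p)
  lower→x false _     = e01
  lower→x true  false = e12
  lower→x true  true  = loop _

  1→lower : ∀ p q → EdgeK 1F (lower p q)
  1→lower false _     = e10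
  1→lower true  false = loop _
  1→lower true  true  = e12

  lower→meet : ∀ p q → EdgeK (lower p q) (enc (p ∧ q))
  lower→meet false _ = e01
  lower→meet true  _ = loop _

  two-steps-from-2 : ∀ {w z} → EdgeK 2F w → EdgeK w z → EdgeK 1F z → EdgeK z 2F → z ≡ 2F
  two-steps-from-2 {z = 0F} _        _  _  ()
  two-steps-from-2 {z = 1F} (loop _) () _  _
  two-steps-from-2 {z = 1F} e23      () _  _
  two-steps-from-2 {z = 2F} _        _  _  _ = refl
  two-steps-from-2 {z = 3F} _        _  () _

  -- f l lies between 1 and 2 and is reached from 2 in two steps (through f u), so it is not 1.
  meet-closed : ∀ s → MeetClosed (restriction s)
  meet-closed (n , f , pol , idem) x y x✓ y✓ =
    t→⇒accepted pol idem (subst₂ EdgeK flower≡2 refl (pol l _ λ k → lower→meet (x k) (y k)))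
    where
    l u : Fin n → Fin 4
    l k = lower (x k) (y k)
    u k = upper (x k) (y k)
    flower≡2 : f l ≡ 2F
    flower≡2 = two-steps-from-2
      (subst₂ EdgeK (accepted⇒t pol idem y✓) refl (pol _ u λ k → y→upper (x k) (y k)))
      (pol u l λ k → upper→lower (x k) (y k))
      (edge-from-const EdgeK pol idem λ k → 1→lower (x k) (y k))
      (subst₂ EdgeK refl (accepted⇒t pol idem x✓) (pol l _ λ k → lower→x (x k) (y k)))

  near : Bool → Fin 4
  near false = 0F
  near true  = 2F

  far : Bool → Fin 4
  far false = 3F
  far true  = 2F

  x→near : ∀ p → EdgeK (enc p) (near p)
  x→near false = e10
  x→near true  = loop _

  near→x : ∀ p → EdgeK (near p) (enc p)
  near→x false = e01
  near→x true  = loop _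

  3→near : ∀ p → EdgeK 3F (near p)
  3→near false = e30
  3→near true  = e32

  y→far : ∀ p q → T p ⊎ T q → EdgeK (enc q) (far p)
  y→far true  false _        = e12
  y→far true  true  _        = loop _
  y→far false true  _        = e23
  y→far false false (inj₁ ())
  y→far false false (inj₂ ())

  2→far : ∀ p → EdgeK 2F (far p)
  2→far false = e23
  2→far true  = loop _

  far→near : ∀ p → EdgeK (far p) (near p)
  far→near false = e30
  far→near true  = loop _

  no-far→near : ∀ {z w} → EdgeK 1F z → EdgeK z 1F → EdgeK 3F z →
    EdgeK 1F w → EdgeK 2F w → ¬ EdgeK w z
  no-far→near {w = 3F} _ _ _ () _ _
  no-far→near {0F} {2F} _ _ _ _ _ ()
  no-far→near {1F} {2F} _ _ () _ _ _
  no-far→near {2F} {2F} _ () _ _ _ _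
  no-far→near {3F} {2F} () _ _ _ _ _

  -- If f (enc x) = f (enc y) = 1, then f near-x is adjacent to 1 both ways and reached from 3, so
  -- it is 0, while f far-x is reached from 1 and from 2, so it is 2; but 2 → 0 is not an edge.
  cover-prime : ∀ s → CoverPrime (restriction s)
  cover-prime (n , f , pol , idem) x y cover with T? (restrict pol idem x) | T? (restrict pol idem y)
  ... | yes x✓ | _      = inj₁ x✓
  ... | no  _  | yes y✓ = inj₂ y✓
  ... | no  x✗ | no  y✗ = contradiction (pol far-x near-x λ k → far→near (x k)) (no-far→near
      (subst₂ EdgeK (rejected⇒o pol idem x✗) refl (pol _ near-x λ k → x→near (x k)))
      (subst₂ EdgeK refl (rejected⇒o pol idem x✗) (pol near-x _ λ k → near→x (x k)))
      (edge-from-const EdgeK pol idem λ k → 3→near (x k))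
      (subst₂ EdgeK (rejected⇒o pol idem y✗) refl (pol _ far-x λ k → y→far (x k) (y k) (cover k)))
      (edge-from-const EdgeK pol idem λ k → 2→far (x k)))
    where
    near-x far-x : Fin n → Fin 4
    near-x k = near (x k)
    far-x  k = far (x k)

  𝐊-in-SET₂ : Interprets 𝐊 SET₂
  𝐊-in-SET₂ = interprets-in-SET₂ meet-closed cover-prime

  SET₂-in-𝐊 : Interprets SET₂ 𝐊
  SET₂-in-𝐊 = Translation.cloneHom (λ ()) (λ ()) (λ c b → does (c ≤? b)) (λ _ ()) ≤?-separates

proposition2p2 : EquiInterpretable SL₂ 𝐃 × EquiInterpretable SET₂ 𝐊
proposition2p2 = (𝔻.SL₂-in-𝐃 , 𝔻.𝐃-in-SL₂) , (𝕂.SET₂-in-𝐊 , 𝕂.𝐊-in-SET₂)
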